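{- For every integer $n\ge3$, with $\delta=2d(n)/n$, we have \[ g(\delta)\le\frac{\delta^4}{8d(n)^3}. \]
   Context: A graph is diamond-free if each of its edges lies in exactly one triangle. $d(n)$ is defined so that $d(n)n^2$ is the maximum number of edges of a diamond-free graph on $n$ vertices. The triforce is the 3-uniform hypergraph on six vertices $1,2,3,1',2',3'$ with edges $\{1,2,3'\},\{1,2',3\},\{1',2,3\}$. For 3-uniform hypergraphs $H,G$, the density of $H$ in $G$ is the number of homomorphisms $H\to G$ (maps $V(H)\to V(G)$ sending edges to edges) divided by $|V(G)|^{|V(H)|}$; the edge density of $G$ is $6e(G)/|V(G)|^3$. For $\delta\in(0,1]$, $g(\delta)$ is the infimum, over all finite 3-uniform hypergraphs with edge density at least $\delta$, of their triforce density. -}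

module Defs where

open import Data.Nat as ℕ using (ℕ; zero; suc; _<ᵇ_)
open import Data.Bool using (Bool; true; false; _∧_; if_then_else_)
open import Data.Fin using (Fin; toℕ)
open import Data.List using (List; map; allFin)
open import Data.Nat.ListAction using (sum)
open import Data.Integer using (+_)
open import Data.Rational using (ℚ; 0ℚ; 1ℚ; _/_; _÷_; _*_; ≢-nonZero)
open import Relation.Nullary using (yes; no)
open import Relation.Binary.PropositionalEquality using (_≡_; _≢_)
import Data.Rational.Properties as ℚP

sumFin : (N : ℕ) → (Fin N → ℕ) → ℕ
sumFin N f = sum (map f (allFin N))

𝟙 : Bool → ℕ
𝟙 true  = 1
𝟙 false = 0

-- the rational a / b, with the convention a / 0 = 0
-- (only ever used with nonzero denominators below)
frac : ℕ → ℕ → ℚ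
frac a zero    = 0ℚ
frac a (suc b) = (+ a) / suc b

-- total rational division, with the convention p / 0 = 0
-- (only ever used with nonzero denominators below)
divQ : ℚ → ℚ → ℚ
divQ p q with q ℚP.≟ 0ℚ
... | yes _  = 0ℚ
... | no q≢0 = _÷_ p q {{≢-nonZero q≢0}}

powQ : ℚ → ℕ → ℚ
powQ p zero    = 1ℚ
powQ p (suc k) = p * powQ p k

record Graph (n : ℕ) : Set where
  field
    adj   : Fin n → Fin n → Bool
    sym   : ∀ u v → adj u v ≡ adj v u
    irrefl : ∀ u → adj u u ≡ false
open Graph public

edgeCount : ∀ {n} → Graph n → ℕ
edgeCount {n} G = sumFin n λ u → sumFin n λ v → 𝟙 ((toℕ u <ᵇ toℕ v) ∧ adj G u v)

trianglesOn : ∀ {n} → Graph n → Fin n → Fin n → ℕ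
trianglesOn {n} G u v = sumFin n λ w → 𝟙 (adj G u w ∧ adj G v w)

DiamondFree : ∀ {n} → Graph n → Set
DiamondFree G = ∀ u v → adj G u v ≡ true → trianglesOn G u v ≡ 1

IsMaxDiamondFreeEdges : ℕ → ℕ → Set
IsMaxDiamondFreeEdges n m =
  (Data.Product.Σ (Graph n) λ G → DiamondFree G Data.Product.× edgeCount G ≡ m)
  Data.Product.× (∀ (G : Graph n) → DiamondFree G → edgeCount G ℕ.≤ m)
  where import Data.Product

dval : ℕ → ℕ → ℚ
dval n m = frac m (n ℕ.* n)

-- 3-uniform hypergraphs on vertex set Fin N
-- (edge predicate on ordered triples, invariant under permutations,
--  true only on triples of distinct vertices; so edges are 3-sets)

record Hypergraph3 (N : ℕ) : Set where
  field
    E      : Fin N → Fin N → Fin N → Bool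
    sym₁₂  : ∀ a b c → E a b c ≡ E b a c
    sym₂₃  : ∀ a b c → E a b c ≡ E a c b
    dist₁₂ : ∀ a b c → E a b c ≡ true → a ≢ b
    dist₂₃ : ∀ a b c → E a b c ≡ true → b ≢ c
    dist₁₃ : ∀ a b c → E a b c ≡ true → a ≢ c
open Hypergraph3 public

edges3 : ∀ {N} → Hypergraph3 N → ℕ
edges3 {N} G = sumFin N λ a → sumFin N λ b → sumFin N λ c →
  𝟙 ((toℕ a <ᵇ toℕ b) ∧ (toℕ b <ᵇ toℕ c) ∧ E G a b c)

edgeDensity : ∀ {N} → Hypergraph3 N → ℚ
edgeDensity {N} G = frac (6 ℕ.* edges3 G) (N ℕ.* N ℕ.* N)

-- number of homomorphisms triforce → G; vertices 1,2,3,1',2',3' are sent to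
-- x1,x2,x3,y1,y2,y3; edges {1,2,3'},{1,2',3},{1',2,3} must go to edges
triforceHoms : ∀ {N} → Hypergraph3 N → ℕ
triforceHoms {N} G =
  sumFin N λ x1 → sumFin N λ x2 → sumFin N λ x3 → sumFin N λ y1 → sumFin N λ y2 → sumFin N λ y3 →
  𝟙 (E G x1 x2 y3 ∧ E G x1 y2 x3 ∧ E G y1 x2 x3)

triforceDensity : ∀ {N} → Hypergraph3 N → ℚ
triforceDensity {N} G =
  frac (triforceHoms G) (N ℕ.* N ℕ.* N ℕ.* N ℕ.* N ℕ.* N)

-- The extremal construction is the triangle hypergraph H of a largest diamond-free
-- graph F on n vertices (m = d n² edges). Every edge of F lies in exactly one
-- triangle, so F has m / 3 triangles and H has edge density 2m / n³ = δ. A triforce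
-- homomorphism x₁x₂y₃, x₁y₂x₃, y₁x₂x₃ into H makes x₁x₂x₃ a triangle of F, and
-- uniqueness of the triangle on each of its edges forces yᵢ = xᵢ; so the
-- homomorphisms are the 2m ordered triangles, of density 2m / n⁶ = δ⁴ / (8 d³).
module Submission where

import Data.Nat
import Defs

module FiniteSums where

  open import Defs using (sumFin)
  open import Data.Nat
  open import Data.Nat.Properties using (+-mono-≤; +-*-semiring)
  open import Data.Fin using (Fin; zero; suc)
  open import Data.List using (tabulate)
  open import Data.List.Properties using (map-tabulate)
  import Data.Nat.ListAction as List
  open import Function using (id; _∘_)
  open import Relation.Binary.PropositionalEquality
  open import Algebra.Properties.Semiring.Sum +-*-semiring public
    using (sum-syntax; sum-cong-≗; ∑-comm; ∑-distrib-+; *-distribˡ-sum; *-distribʳ-sum)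

  sumFin≡∑ : ∀ N (f : Fin N → ℕ) → sumFin N f ≡ ∑[ i < N ] f i
  sumFin≡∑ N f = trans (cong List.sum (map-tabulate id f)) (sum-tabulate f)
    where
    sum-tabulate : ∀ {N} (g : Fin N → ℕ) → List.sum (tabulate g) ≡ ∑[ i < N ] g i
    sum-tabulate {zero}  g = refl
    sum-tabulate {suc N} g = cong (g zero +_) (sum-tabulate (g ∘ suc))

  sumFin-∑ : ∀ {N} {f g : Fin N → ℕ} → (∀ i → f i ≡ g i) → sumFin N f ≡ ∑[ i < N ] g i
  sumFin-∑ {N} {f} f≗g = trans (sumFin≡∑ N f) (sum-cong-≗ f≗g)

  ∑-mono-≤ : ∀ {N} {f g : Fin N → ℕ} → (∀ i → f i ≤ g i) → ∑[ i < N ] f i ≤ ∑[ i < N ] g i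
  ∑-mono-≤ {zero}  f≤g = z≤n
  ∑-mono-≤ {suc N} f≤g = +-mono-≤ (f≤g zero) (∑-mono-≤ (f≤g ∘ suc))

  ∑³ : ∀ {N} → (Fin N → Fin N → Fin N → ℕ) → ℕ
  ∑³ {N} f = ∑[ a < N ] ∑[ b < N ] ∑[ c < N ] f a b c

  ∑³-mono-≤ : ∀ {N} {f g : Fin N → Fin N → Fin N → ℕ} →
    (∀ a b c → f a b c ≤ g a b c) → ∑³ f ≤ ∑³ g
  ∑³-mono-≤ f≤g = ∑-mono-≤ λ a → ∑-mono-≤ λ b → ∑-mono-≤ λ c → f≤g a b c

  ∑³-distrib-+ : ∀ {N} (f g : Fin N → Fin N → Fin N → ℕ) →
    ∑³ (λ a b c → f a b c + g a b c) ≡ ∑³ f + ∑³ g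
  ∑³-distrib-+ {N} f g =
    trans (sum-cong-≗ λ a → trans (sum-cong-≗ λ b → ∑-distrib-+ (f a b) (g a b))
                                  (∑-distrib-+ (λ b → ∑[ c < N ] f a b c) (λ b → ∑[ c < N ] g a b c)))
          (∑-distrib-+ (λ a → ∑[ b < N ] ∑[ c < N ] f a b c) (λ a → ∑[ b < N ] ∑[ c < N ] g a b c))

  ∑³-rotate : ∀ {N} (f : Fin N → Fin N → Fin N → ℕ) → ∑³ (λ a b c → f c a b) ≡ ∑³ f
  ∑³-rotate {N} f =
    trans (sum-cong-≗ λ a → ∑-comm λ b c → f c a b) (∑-comm λ a c → ∑[ b < N ] f c a b)

  ∑³-swap₂₃ : ∀ {N} (f : Fin N → Fin N → Fin N → ℕ) → ∑³ (λ a b c → f a c b) ≡ ∑³ f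
  ∑³-swap₂₃ f = sum-cong-≗ λ a → ∑-comm λ b c → f a c b

  ∑-product₃ : ∀ {N} (f g h : Fin N → ℕ) →
    ∑³ (λ a b c → f a * (g b * h c)) ≡ (∑[ a < N ] f a) * ((∑[ b < N ] g b) * (∑[ c < N ] h c))
  ∑-product₃ {N} f g h = begin
    ∑³ (λ a b c → f a * (g b * h c))
      ≡⟨ sum-cong-≗ (λ a → trans (sum-cong-≗ λ b → sym (*-distribˡ-sum (f a) (λ c → g b * h c)))
                                 (sym (*-distribˡ-sum (f a) λ b → ∑[ c < N ] (g b * h c)))) ⟩
    ∑[ a < N ] (f a * ∑[ b < N ] ∑[ c < N ] (g b * h c))
      ≡⟨ sym (*-distribʳ-sum (∑[ b < N ] ∑[ c < N ] (g b * h c)) f) ⟩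
    (∑[ a < N ] f a) * (∑[ b < N ] ∑[ c < N ] (g b * h c))
      ≡⟨ cong ((∑[ a < N ] f a) *_) (trans (sum-cong-≗ λ b → sym (*-distribˡ-sum (g b) h))
                                           (sym (*-distribʳ-sum (∑[ c < N ] h c) g))) ⟩
    (∑[ a < N ] f a) * ((∑[ b < N ] g b) * (∑[ c < N ] h c)) ∎
    where open ≡-Reasoning

module Indicators where

  open import Defs using (𝟙)
  open import Data.Nat
  open import Data.Nat.Properties using (+-identityʳ)
  open import Data.Bool using (true; false; _∧_)
  open import Data.Product using (_×_; _,_)
  open import Function using (_∘_)
  open import Relation.Binary.PropositionalEquality
  open import Relation.Nullary using (contradiction)

  ∧-≡true : ∀ {x y} → x ≡ true → y ≡ true → x ∧ y ≡ true
  ∧-≡true refl refl = refl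

  ∧-≡true⁻¹ : ∀ x y → x ∧ y ≡ true → x ≡ true × y ≡ true
  ∧-≡true⁻¹ true true _ = refl , refl

  <ᵇ≡true : ∀ {m n} → m < n → (m <ᵇ n) ≡ true
  <ᵇ≡true {zero}  {suc n} _         = refl
  <ᵇ≡true {suc m} {suc n} (s≤s m<n) = <ᵇ≡true m<n

  𝟙-∧ : ∀ x y → 𝟙 (x ∧ y) ≡ 𝟙 x * 𝟙 y
  𝟙-∧ true  y = sym (+-identityʳ (𝟙 y))
  𝟙-∧ false y = refl

  𝟙≡1 : ∀ {b} → b ≡ true → 𝟙 b ≡ 1
  𝟙≡1 refl = refl

  𝟙-≤ : ∀ {b r} → (b ≡ true → 1 ≤ r) → 𝟙 b ≤ r
  𝟙-≤ {false} _   = z≤n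
  𝟙-≤ {true}  1≤r = 1≤r refl

  𝟙*-≤ : ∀ b {r} → (b ≡ true → r ≤ 1) → 𝟙 b * r ≤ 𝟙 b
  𝟙*-≤ false _   = z≤n
  𝟙*-≤ true  r≤1 = subst (_≤ 1) (sym (+-identityʳ _)) (r≤1 refl)

  𝟙<ᵇ+𝟙>ᵇ≡1 : ∀ m n → m ≢ n → 𝟙 (m <ᵇ n) + 𝟙 (n <ᵇ m) ≡ 1
  𝟙<ᵇ+𝟙>ᵇ≡1 zero    zero    m≢n = contradiction refl m≢n
  𝟙<ᵇ+𝟙>ᵇ≡1 zero    (suc n) m≢n = refl
  𝟙<ᵇ+𝟙>ᵇ≡1 (suc m) zero    m≢n = refl
  𝟙<ᵇ+𝟙>ᵇ≡1 (suc m) (suc n) m≢n = 𝟙<ᵇ+𝟙>ᵇ≡1 m n (m≢n ∘ cong suc)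

module TriangleHypergraph {n : Data.Nat.ℕ} (F : Defs.Graph n) where

  open import Defs hiding (sym)
  open FiniteSums
  open Indicators
  open import Data.Nat
  open import Data.Nat.Properties
    using (≤-trans; ≤-reflexive; m≤m+n; m≤n+m; *-identityˡ; +-identityʳ; *-assoc; *-mono-≤; <-cmp; module ≤-Reasoning)
  open import Data.Nat.Tactic.RingSolver using (solve-∀)
  open import Data.Fin using (Fin; toℕ)
  open import Data.Fin.Properties using (toℕ-injective)
  open import Data.Bool using (Bool; true; false; _∧_)
  open import Data.Bool.Properties using (∧-comm; ∧-zeroʳ; ∧-identityʳ)
  open import Data.Product using (_×_; _,_; proj₁; proj₂)
  open import Function using (_∘_)
  open import Relation.Binary.PropositionalEquality
  open import Relation.Binary.Definitions using (tri<; tri≈; tri>)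
  open import Relation.Nullary using (contradiction)

  adj⇒≢ : ∀ {u v} → adj F u v ≡ true → u ≢ v
  adj⇒≢ {u} uv refl = contradiction (trans (sym (irrefl F u)) uv) λ ()

  adj-sym : ∀ {u v} → adj F u v ≡ true → adj F v u ≡ true
  adj-sym {u} {v} uv = trans (Graph.sym F v u) uv

  isTriangle : Fin n → Fin n → Fin n → Bool
  isTriangle a b c = adj F a b ∧ adj F a c ∧ adj F b c

  isTriangle⇒adj : ∀ a b c → isTriangle a b c ≡ true →
    adj F a b ≡ true × adj F a c ≡ true × adj F b c ≡ true
  isTriangle⇒adj a b c t =
    let ab , ac∧bc = ∧-≡true⁻¹ (adj F a b) _ t
        ac , bc    = ∧-≡true⁻¹ (adj F a c) (adj F b c) ac∧bc
    in ab , ac , bc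

  isTriangle-swap₁₂ : ∀ a b c → isTriangle a b c ≡ isTriangle b a c
  isTriangle-swap₁₂ a b c rewrite Graph.sym F b a = cong (adj F a b ∧_) (∧-comm (adj F a c) (adj F b c))

  isTriangle-swap₂₃ : ∀ a b c → isTriangle a b c ≡ isTriangle a c b
  isTriangle-swap₂₃ a b c rewrite Graph.sym F c b = ∧-leftComm (adj F a b) (adj F a c) (adj F b c)
    where
    ∧-leftComm : ∀ x y z → x ∧ y ∧ z ≡ y ∧ x ∧ z
    ∧-leftComm true  y z = refl
    ∧-leftComm false y z = sym (∧-zeroʳ y)

  triangleHypergraph : Hypergraph3 n
  triangleHypergraph = record
    { E      = isTriangle
    ; sym₁₂  = isTriangle-swap₁₂
    ; sym₂₃  = isTriangle-swap₂₃
    ; dist₁₂ = λ a b c → adj⇒≢ ∘ proj₁ ∘ isTriangle⇒adj a b c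
    ; dist₂₃ = λ a b c → adj⇒≢ ∘ proj₂ ∘ proj₂ ∘ isTriangle⇒adj a b c
    ; dist₁₃ = λ a b c → adj⇒≢ ∘ proj₁ ∘ proj₂ ∘ isTriangle⇒adj a b c
    }

  orderedEdge : Fin n → Fin n → ℕ
  orderedEdge u v = 𝟙 ((toℕ u <ᵇ toℕ v) ∧ adj F u v)

  commonNeighbour : Fin n → Fin n → Fin n → ℕ
  commonNeighbour u v w = 𝟙 (adj F u w ∧ adj F v w)

  sortedTriangle : Fin n → Fin n → Fin n → ℕ
  sortedTriangle a b c = 𝟙 ((toℕ a <ᵇ toℕ b) ∧ (toℕ b <ᵇ toℕ c) ∧ isTriangle a b c)

  triforceHom : Fin n → Fin n → Fin n → Fin n → Fin n → Fin n → ℕ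
  triforceHom x₁ x₂ x₃ y₁ y₂ y₃ = 𝟙 (isTriangle x₁ x₂ y₃ ∧ isTriangle x₁ y₂ x₃ ∧ isTriangle y₁ x₂ x₃)

  edgeCount≡∑ : edgeCount F ≡ ∑[ u < n ] ∑[ v < n ] orderedEdge u v
  edgeCount≡∑ = sumFin-∑ λ u → sumFin≡∑ n (orderedEdge u)

  trianglesOn≡∑ : ∀ u v → trianglesOn F u v ≡ ∑[ w < n ] commonNeighbour u v w
  trianglesOn≡∑ u v = sumFin≡∑ n (commonNeighbour u v)

  edges3≡∑³ : edges3 triangleHypergraph ≡ ∑³ sortedTriangle
  edges3≡∑³ = sumFin-∑ λ a → sumFin-∑ λ b → sumFin≡∑ n (sortedTriangle a b)

  triforceHoms≡∑³∑³ : triforceHoms triangleHypergraph ≡ ∑³ (λ x₁ x₂ x₃ → ∑³ (triforceHom x₁ x₂ x₃))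
  triforceHoms≡∑³∑³ =
    sumFin-∑ λ x₁ → sumFin-∑ λ x₂ → sumFin-∑ λ x₃ → sumFin-∑ λ y₁ → sumFin-∑ λ y₂ →
    sumFin≡∑ n (triforceHom x₁ x₂ x₃ y₁ y₂)

  𝟙adj≡orderedEdge+orderedEdge : ∀ u v → 𝟙 (adj F u v) ≡ orderedEdge u v + orderedEdge v u
  𝟙adj≡orderedEdge+orderedEdge u v rewrite Graph.sym F v u with adj F u v in uv
  ... | false rewrite ∧-zeroʳ (toℕ u <ᵇ toℕ v) | ∧-zeroʳ (toℕ v <ᵇ toℕ u) = refl
  ... | true  rewrite ∧-identityʳ (toℕ u <ᵇ toℕ v) | ∧-identityʳ (toℕ v <ᵇ toℕ u) =
    sym (𝟙<ᵇ+𝟙>ᵇ≡1 (toℕ u) (toℕ v) (adj⇒≢ uv ∘ toℕ-injective))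

  ∑∑𝟙adj≡2*edgeCount : ∑[ u < n ] ∑[ v < n ] 𝟙 (adj F u v) ≡ 2 * edgeCount F
  ∑∑𝟙adj≡2*edgeCount = begin
    ∑[ u < n ] ∑[ v < n ] 𝟙 (adj F u v)
      ≡⟨ sum-cong-≗ (λ u → trans (sum-cong-≗ (𝟙adj≡orderedEdge+orderedEdge u))
                                 (∑-distrib-+ (orderedEdge u) (λ v → orderedEdge v u))) ⟩
    ∑[ u < n ] (∑[ v < n ] orderedEdge u v + ∑[ v < n ] orderedEdge v u)
      ≡⟨ ∑-distrib-+ (λ u → ∑[ v < n ] orderedEdge u v) (λ u → ∑[ v < n ] orderedEdge v u) ⟩
    ∑[ u < n ] ∑[ v < n ] orderedEdge u v + ∑[ u < n ] ∑[ v < n ] orderedEdge v u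
      ≡⟨ cong (∑[ u < n ] ∑[ v < n ] orderedEdge u v +_) (∑-comm λ u v → orderedEdge v u) ⟩
    ∑[ u < n ] ∑[ v < n ] orderedEdge u v + ∑[ u < n ] ∑[ v < n ] orderedEdge u v
      ≡⟨ cong (λ e → e + e) (sym edgeCount≡∑) ⟩
    edgeCount F + edgeCount F
      ≡⟨ cong (edgeCount F +_) (sym (+-identityʳ _)) ⟩
    2 * edgeCount F ∎
    where open ≡-Reasoning

  -- According as c < a, a < c < b or b < c, the triangle {a, b, c} is counted by
  -- exactly one of the three summands.
  orderedEdge*commonNeighbour≤ : ∀ a b c → orderedEdge a b * commonNeighbour a b c ≤
    sortedTriangle c a b + sortedTriangle a c b + sortedTriangle a b c
  orderedEdge*commonNeighbour≤ a b c =
    subst (_≤ S₁ + S₂ + S₃) (𝟙-∧ ((toℕ a <ᵇ toℕ b) ∧ adj F a b) (adj F a c ∧ adj F b c)) (𝟙-≤ λ e →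
      let a<b∧ab , ac∧bc = ∧-≡true⁻¹ ((toℕ a <ᵇ toℕ b) ∧ adj F a b) (adj F a c ∧ adj F b c) e
          a<b , ab       = ∧-≡true⁻¹ (toℕ a <ᵇ toℕ b) (adj F a b) a<b∧ab
          ac , bc        = ∧-≡true⁻¹ (adj F a c) (adj F b c) ac∧bc
      in placeC a<b ab ac bc)
    where
    S₁ = sortedTriangle c a b
    S₂ = sortedTriangle a c b
    S₃ = sortedTriangle a b c

    placeC : (toℕ a <ᵇ toℕ b) ≡ true → adj F a b ≡ true → adj F a c ≡ true → adj F b c ≡ true →
      1 ≤ S₁ + S₂ + S₃
    placeC a<b ab ac bc with <-cmp (toℕ c) (toℕ a)
    ... | tri< c<a _ _ = ≤-trans (≤-reflexive (sym (𝟙≡1 (∧-≡true (<ᵇ≡true c<a)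
            (∧-≡true a<b (∧-≡true (adj-sym ac) (∧-≡true (adj-sym bc) ab)))))))
            (≤-trans (m≤m+n S₁ S₂) (m≤m+n _ S₃))
    ... | tri≈ _ c≡a _ = contradiction (sym (toℕ-injective c≡a)) (adj⇒≢ ac)
    ... | tri> _ _ a<c with <-cmp (toℕ c) (toℕ b)
    ...   | tri< c<b _ _ = ≤-trans (≤-reflexive (sym (𝟙≡1 (∧-≡true (<ᵇ≡true a<c)
              (∧-≡true (<ᵇ≡true c<b) (∧-≡true ac (∧-≡true ab (adj-sym bc))))))))
              (≤-trans (m≤n+m S₂ S₁) (m≤m+n _ S₃))
    ...   | tri≈ _ c≡b _ = contradiction (sym (toℕ-injective c≡b)) (adj⇒≢ bc)
    ...   | tri> _ _ b<c = ≤-trans (≤-reflexive (sym (𝟙≡1 (∧-≡true a<b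
              (∧-≡true (<ᵇ≡true b<c) (∧-≡true ab (∧-≡true ac bc)))))))
              (m≤n+m S₃ _)

  edgeCount≤3*edges3 : (∀ u v → adj F u v ≡ true → 1 ≤ trianglesOn F u v) →
    edgeCount F ≤ 3 * edges3 triangleHypergraph
  edgeCount≤3*edges3 onSomeTriangle = begin
    edgeCount F
      ≡⟨ edgeCount≡∑ ⟩
    ∑[ a < n ] ∑[ b < n ] orderedEdge a b
      ≤⟨ ∑-mono-≤ (λ a → ∑-mono-≤ (orderedEdge≤orderedEdge*trianglesOn a)) ⟩
    ∑[ a < n ] ∑[ b < n ] (orderedEdge a b * trianglesOn F a b)
      ≡⟨ sum-cong-≗ (λ a → sum-cong-≗ λ b →
           trans (cong (orderedEdge a b *_) (trianglesOn≡∑ a b)) (*-distribˡ-sum (orderedEdge a b) (commonNeighbour a b))) ⟩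
    ∑³ (λ a b c → orderedEdge a b * commonNeighbour a b c)
      ≤⟨ ∑³-mono-≤ orderedEdge*commonNeighbour≤ ⟩
    ∑³ (λ a b c → sortedTriangle c a b + sortedTriangle a c b + sortedTriangle a b c)
      ≡⟨ trans (∑³-distrib-+ (λ a b c → sortedTriangle c a b + sortedTriangle a c b) sortedTriangle)
               (cong (_+ ∑³ sortedTriangle)
                     (∑³-distrib-+ (λ a b c → sortedTriangle c a b) (λ a b c → sortedTriangle a c b))) ⟩
    ∑³ (λ a b c → sortedTriangle c a b) + ∑³ (λ a b c → sortedTriangle a c b) + ∑³ sortedTriangle
      ≡⟨ cong₂ (λ x y → x + y + ∑³ sortedTriangle) (∑³-rotate sortedTriangle) (∑³-swap₂₃ sortedTriangle) ⟩
    ∑³ sortedTriangle + ∑³ sortedTriangle + ∑³ sortedTriangle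
      ≡⟨ trans (x+x+x≡3*x (∑³ sortedTriangle)) (cong (3 *_) (sym edges3≡∑³)) ⟩
    3 * edges3 triangleHypergraph ∎
    where
    open ≤-Reasoning

    orderedEdge≤orderedEdge*trianglesOn : ∀ a b → orderedEdge a b ≤ orderedEdge a b * trianglesOn F a b
    orderedEdge≤orderedEdge*trianglesOn a b with (toℕ a <ᵇ toℕ b) ∧ adj F a b in a<b∧ab
    ... | false = z≤n
    ... | true  = subst (1 ≤_) (sym (*-identityˡ _)) (onSomeTriangle a b (proj₂ (∧-≡true⁻¹ (toℕ a <ᵇ toℕ b) (adj F a b) a<b∧ab)))

    x+x+x≡3*x : ∀ x → x + x + x ≡ 3 * x
    x+x+x≡3*x = solve-∀

  module _ (onAtMostOneTriangle : ∀ u v → adj F u v ≡ true → trianglesOn F u v ≤ 1) where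

    triforceHom≤ : ∀ x₁ x₂ x₃ y₁ y₂ y₃ → triforceHom x₁ x₂ x₃ y₁ y₂ y₃ ≤
      (𝟙 (isTriangle x₁ x₂ x₃) * commonNeighbour x₂ x₃ y₁) *
      (commonNeighbour x₁ x₃ y₂ * commonNeighbour x₁ x₂ y₃)
    triforceHom≤ x₁ x₂ x₃ y₁ y₂ y₃ = 𝟙-≤ λ hom →
      let t₃ , t₂∧t₁         = ∧-≡true⁻¹ (isTriangle x₁ x₂ y₃) _ hom
          t₂ , t₁            = ∧-≡true⁻¹ (isTriangle x₁ y₂ x₃) (isTriangle y₁ x₂ x₃) t₂∧t₁
          x₁x₂ , x₁y₃ , x₂y₃ = isTriangle⇒adj x₁ x₂ y₃ t₃
          x₁y₂ , x₁x₃ , y₂x₃ = isTriangle⇒adj x₁ y₂ x₃ t₂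
          y₁x₂ , y₁x₃ , x₂x₃ = isTriangle⇒adj y₁ x₂ x₃ t₁
      in ≤-reflexive (sym (cong₂ _*_
           (cong₂ _*_ (𝟙≡1 (∧-≡true x₁x₂ (∧-≡true x₁x₃ x₂x₃)))
                      (𝟙≡1 (∧-≡true (adj-sym y₁x₂) (adj-sym y₁x₃))))
           (cong₂ _*_ (𝟙≡1 (∧-≡true x₁y₂ (adj-sym y₂x₃)))
                      (𝟙≡1 (∧-≡true x₁y₃ x₂y₃)))))

    ∑³triforceHom≤𝟙isTriangle : ∀ x₁ x₂ x₃ → ∑³ (triforceHom x₁ x₂ x₃) ≤ 𝟙 (isTriangle x₁ x₂ x₃)
    ∑³triforceHom≤𝟙isTriangle x₁ x₂ x₃ = begin
      ∑³ (triforceHom x₁ x₂ x₃)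
        ≤⟨ ∑³-mono-≤ (triforceHom≤ x₁ x₂ x₃) ⟩
      ∑³ (λ y₁ y₂ y₃ → (t * commonNeighbour x₂ x₃ y₁) *
                       (commonNeighbour x₁ x₃ y₂ * commonNeighbour x₁ x₂ y₃))
        ≡⟨ ∑-product₃ (λ y₁ → t * commonNeighbour x₂ x₃ y₁) (commonNeighbour x₁ x₃) (commonNeighbour x₁ x₂) ⟩
      (∑[ y₁ < n ] (t * commonNeighbour x₂ x₃ y₁)) *
        ((∑[ y₂ < n ] commonNeighbour x₁ x₃ y₂) * (∑[ y₃ < n ] commonNeighbour x₁ x₂ y₃))
        ≡⟨ cong₂ (λ p q → p * q)
             (trans (sym (*-distribˡ-sum t (commonNeighbour x₂ x₃))) (cong (t *_) (sym (trianglesOn≡∑ x₂ x₃))))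
             (sym (cong₂ _*_ (trianglesOn≡∑ x₁ x₃) (trianglesOn≡∑ x₁ x₂))) ⟩
      (t * trianglesOn F x₂ x₃) * (trianglesOn F x₁ x₃ * trianglesOn F x₁ x₂)
        ≡⟨ *-assoc t _ _ ⟩
      t * (trianglesOn F x₂ x₃ * (trianglesOn F x₁ x₃ * trianglesOn F x₁ x₂))
        ≤⟨ 𝟙*-≤ (isTriangle x₁ x₂ x₃) eachOnOneTriangle ⟩
      t ∎
      where
      open ≤-Reasoning
      t = 𝟙 (isTriangle x₁ x₂ x₃)

      eachOnOneTriangle : isTriangle x₁ x₂ x₃ ≡ true →
        trianglesOn F x₂ x₃ * (trianglesOn F x₁ x₃ * trianglesOn F x₁ x₂) ≤ 1
      eachOnOneTriangle tri =
        let x₁x₂ , x₁x₃ , x₂x₃ = isTriangle⇒adj x₁ x₂ x₃ tri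
        in *-mono-≤ (onAtMostOneTriangle _ _ x₂x₃)
             (*-mono-≤ (onAtMostOneTriangle _ _ x₁x₃) (onAtMostOneTriangle _ _ x₁x₂))

    ∑𝟙isTriangle≤𝟙adj : ∀ x₁ x₂ → ∑[ x₃ < n ] 𝟙 (isTriangle x₁ x₂ x₃) ≤ 𝟙 (adj F x₁ x₂)
    ∑𝟙isTriangle≤𝟙adj x₁ x₂ = begin
      ∑[ x₃ < n ] 𝟙 (isTriangle x₁ x₂ x₃)
        ≡⟨ sum-cong-≗ (λ x₃ → 𝟙-∧ (adj F x₁ x₂) (adj F x₁ x₃ ∧ adj F x₂ x₃)) ⟩
      ∑[ x₃ < n ] (𝟙 (adj F x₁ x₂) * commonNeighbour x₁ x₂ x₃)
        ≡⟨ sym (*-distribˡ-sum (𝟙 (adj F x₁ x₂)) (commonNeighbour x₁ x₂)) ⟩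
      𝟙 (adj F x₁ x₂) * (∑[ x₃ < n ] commonNeighbour x₁ x₂ x₃)
        ≡⟨ cong (𝟙 (adj F x₁ x₂) *_) (sym (trianglesOn≡∑ x₁ x₂)) ⟩
      𝟙 (adj F x₁ x₂) * trianglesOn F x₁ x₂
        ≤⟨ 𝟙*-≤ (adj F x₁ x₂) (onAtMostOneTriangle x₁ x₂) ⟩
      𝟙 (adj F x₁ x₂) ∎
      where open ≤-Reasoning

    triforceHoms≤2*edgeCount : triforceHoms triangleHypergraph ≤ 2 * edgeCount F
    triforceHoms≤2*edgeCount = begin
      triforceHoms triangleHypergraph
        ≡⟨ triforceHoms≡∑³∑³ ⟩
      ∑³ (λ x₁ x₂ x₃ → ∑³ (triforceHom x₁ x₂ x₃))
        ≤⟨ ∑³-mono-≤ ∑³triforceHom≤𝟙isTriangle ⟩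
      ∑³ (λ x₁ x₂ x₃ → 𝟙 (isTriangle x₁ x₂ x₃))
        ≤⟨ ∑-mono-≤ (λ x₁ → ∑-mono-≤ (∑𝟙isTriangle≤𝟙adj x₁)) ⟩
      ∑[ u < n ] ∑[ v < n ] 𝟙 (adj F u v)
        ≡⟨ ∑∑𝟙adj≡2*edgeCount ⟩
      2 * edgeCount F ∎
      where open ≤-Reasoning

module Fractions where

  open import Defs using (frac; divQ; powQ; dval)
  open import Data.Nat using (ℕ; zero; suc; _*_; _^_; _≤_)
  import Data.Nat.Properties as ℕP
  open import Data.Nat.Solver using (module +-*-Solver)
  open import Data.Nat.Tactic.RingSolver using (solve-∀)
  open import Data.Integer as ℤ using (+_)
  import Data.Integer.Properties as ℤP
  open import Data.Rational using (ℚ; 0ℚ; _/_; 1/_; toℚᵘ; ≢-nonZero)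
  import Data.Rational as ℚ
  import Data.Rational.Properties as ℚP
  open import Data.Rational.Unnormalised as ℚᵘ using (mkℚᵘ; _≃_; *≡*; *≤*)
  import Data.Rational.Unnormalised.Properties as ℚᵘP
  open import Data.Empty using (⊥)
  open import Relation.Binary.PropositionalEquality
  open import Relation.Nullary using (yes; no; contradiction)

  infix 4 _≐_⁄_

  _≐_⁄_ : ℚ → ℕ → ℕ → Set
  p ≐ a ⁄ zero  = ⊥
  p ≐ a ⁄ suc b = toℚᵘ p ≃ mkℚᵘ (+ a) b

  frac-≐ : ∀ a b → frac a (suc b) ≐ a ⁄ suc b
  frac-≐ a b = ℚP.toℚᵘ-fromℚᵘ (mkℚᵘ (+ a) b)

  *-≐ : ∀ {p q a b c d} → p ≐ a ⁄ b → q ≐ c ⁄ d → p ℚ.* q ≐ a * c ⁄ b * d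
  *-≐ {p} {q} {a} {suc _} {c} {suc _} p≐ q≐ = ℚᵘP.≃-trans (ℚP.toℚᵘ-homo-* p q)
    (ℚᵘP.≃-trans (ℚᵘP.*-cong p≐ q≐) (ℚᵘP.≃-reflexive (cong (λ z → mkℚᵘ z _) (sym (ℤP.pos-* a c)))))

  powQ-≐ : ∀ {p a b} → p ≐ a ⁄ b → ∀ k → powQ p k ≐ a ^ k ⁄ b ^ k
  powQ-≐ p≐ zero    = ℚᵘP.≃-refl
  powQ-≐ p≐ (suc k) = *-≐ p≐ (powQ-≐ p≐ k)

  1/-cong : ∀ {x y} .{{_ : ℚᵘ.NonZero x}} .{{_ : ℚᵘ.NonZero y}} → x ≃ y → ℚᵘ.1/ x ≃ ℚᵘ.1/ y
  1/-cong {x} {y} x≃y = begin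
    ℚᵘ.1/ x                           ≈⟨ ℚᵘP.*-identityʳ (ℚᵘ.1/ x) ⟨
    ℚᵘ.1/ x ℚᵘ.* ℚᵘ.1ℚᵘ                ≈⟨ ℚᵘP.*-congˡ {ℚᵘ.1/ x} (ℚᵘP.*-inverseʳ y) ⟨
    ℚᵘ.1/ x ℚᵘ.* (y ℚᵘ.* ℚᵘ.1/ y)      ≈⟨ ℚᵘP.*-assoc (ℚᵘ.1/ x) y (ℚᵘ.1/ y) ⟨
    (ℚᵘ.1/ x ℚᵘ.* y) ℚᵘ.* ℚᵘ.1/ y      ≈⟨ ℚᵘP.*-congʳ {ℚᵘ.1/ y} (ℚᵘP.*-congˡ {ℚᵘ.1/ x} x≃y) ⟨
    (ℚᵘ.1/ x ℚᵘ.* x) ℚᵘ.* ℚᵘ.1/ y      ≈⟨ ℚᵘP.*-congʳ {ℚᵘ.1/ y} (ℚᵘP.*-inverseˡ x) ⟩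
    ℚᵘ.1ℚᵘ ℚᵘ.* ℚᵘ.1/ y                ≈⟨ ℚᵘP.*-identityˡ (ℚᵘ.1/ y) ⟩
    ℚᵘ.1/ y                           ∎
    where open ℚᵘP.≃-Reasoning

  divQ-≐ : ∀ {p q a b c d} → p ≐ a ⁄ b → q ≐ suc c ⁄ d → divQ p q ≐ a * d ⁄ b * suc c
  divQ-≐ {p} {q} {c = c} {d = suc d} p≐ q≐ with q ℚP.≟ 0ℚ
  ... | yes refl = contradiction q≐ λ { (*≡* ()) }
  ... | no q≢0   = *-≐ {p} {1/ q} p≐ 1/q≐
    where
    instance _ = ≢-nonZero q≢0
    1/q≐ : 1/ q ≐ suc d ⁄ suc c
    1/q≐ = ℚᵘP.≃-trans (ℚP.toℚᵘ-homo-1/ q) (1/-cong q≐)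

  ≐-≤ : ∀ {p q a b c d} → p ≐ a ⁄ b → q ≐ c ⁄ d → a * d ≤ c * b → p ℚ.≤ q
  ≐-≤ {p} {q} {a} {suc b} {c} {suc d} p≐ q≐ ad≤cb = ℚP.toℚᵘ-cancel-≤
    (ℚᵘP.≤-respˡ-≃ (ℚᵘP.≃-sym p≐) (ℚᵘP.≤-respʳ-≃ (ℚᵘP.≃-sym q≐)
      (*≤* (subst₂ ℤ._≤_ (ℤP.pos-* a (suc d)) (ℤP.pos-* c (suc b)) (ℤ.+≤+ ad≤cb)))))

  δ : ℕ → ℚ → ℚ
  δ n d = divQ ((+ 2 / 1) ℚ.* d) (+ n / 1)

  triforceBound : ℕ → ℚ → ℚ
  triforceBound n d = divQ (powQ (δ n d) 4) ((+ 8 / 1) ℚ.* powQ d 3)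

  δ-≐ : ∀ {d a b} k → d ≐ a ⁄ b → δ (suc k) d ≐ 2 * a * 1 ⁄ 1 * b * suc k
  δ-≐ k d≐ = divQ-≐ (*-≐ (frac-≐ 2 0) d≐) (frac-≐ (suc k) 0)

  triforceBound-≐ : ∀ {d a b} k → d ≐ suc a ⁄ b →
    triforceBound (suc k) d ≐ (2 * suc a * 1) ^ 4 * (1 * b ^ 3)
                            ⁄ (1 * b * suc k) ^ 4 * (8 * suc a ^ 3)
  triforceBound-≐ k d≐ = divQ-≐ (powQ-≐ (δ-≐ k d≐) 4) (*-≐ (frac-≐ 8 0) (powQ-≐ d≐ 3))

  δ≤frac : ∀ k m e → 2 * m ≤ 6 * e →
    δ (suc k) (dval (suc k) m) ℚ.≤ frac (6 * e) (suc k * suc k * suc k)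
  δ≤frac k m e 2m≤6e = ≐-≤ (δ-≐ k (frac-≐ m _)) (frac-≐ (6 * e) _)
    (subst₂ _≤_ (lhs m (suc k)) (rhs e (suc k)) (ℕP.*-monoˡ-≤ (suc k * suc k * suc k) 2m≤6e))
    where
    lhs : ∀ m n → 2 * m * (n * n * n) ≡ 2 * m * 1 * (n * n * n)
    lhs = solve-∀
    rhs : ∀ e n → 6 * e * (n * n * n) ≡ 6 * e * (1 * (n * n) * n)
    rhs = solve-∀

  frac≤triforceBound : ∀ k m h → h ≤ 2 * m →
    frac h (suc k * suc k * suc k * suc k * suc k * suc k) ℚ.≤ triforceBound (suc k) (dval (suc k) m)
  -- For m = 0 the bound is 0ℚ, by the convention divQ p 0ℚ = 0ℚ.
  frac≤triforceBound k zero h h≤0 rewrite ℕP.n≤0⇒n≡0 h≤0 =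
    subst₂ ℚ._≤_ (sym (ℚP.0/n≡0 (suc k * suc k * suc k * suc k * suc k * suc k)))
                 (sym (cong (triforceBound (suc k)) (ℚP.0/n≡0 (suc k * suc k)))) ℚP.≤-refl
  frac≤triforceBound k m@(suc _) h h≤2m =
    ≐-≤ (frac-≐ h _) (triforceBound-≐ k (frac-≐ m _))
      (subst (h * D ≤_) (bound-identity m (suc k)) (ℕP.*-monoˡ-≤ D h≤2m))
    where
    D : ℕ
    D = (1 * (suc k * suc k) * suc k) ^ 4 * (8 * m ^ 3)

    open +-*-Solver
    bound-identity : ∀ m n →
      2 * m * ((1 * (n * n) * n) ^ 4 * (8 * m ^ 3))
        ≡ (2 * m * 1) ^ 4 * (1 * (n * n) ^ 3) * (n * n * n * n * n * n)
    bound-identity = solve 2 (λ m n →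
      con 2 :* m :* ((con 1 :* (n :* n) :* n) :^ 4 :* (con 8 :* m :^ 3))
        := (con 2 :* m :* con 1) :^ 4 :* (con 1 :* (n :* n) :^ 3) :* (n :* n :* n :* n :* n :* n)) refl

open import Defs
open import Data.Nat using (ℕ; _≤_)
open import Data.Product using (Σ; _×_; ∃-syntax)
open import Data.Rational using (ℚ; 0ℚ; _<_; _+_; _*_; _/_)
open import Data.Integer using (+_)
import Data.Rational as ℚ
open import Data.Nat using (suc; s≤s; z≤n)
import Data.Nat as ℕ
import Data.Nat.Properties as ℕP
import Data.Rational.Properties as ℚP
open import Data.Product using (_,_)
open import Relation.Binary.PropositionalEquality using (subst) renaming (sym to ≡-sym)
open TriangleHypergraph using (triangleHypergraph; edgeCount≤3*edges3; triforceHoms≤2*edgeCount)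
open Fractions using (δ≤frac; frac≤triforceBound)

lemma2p1 : (n : ℕ) → 3 ≤ n → (m : ℕ) → IsMaxDiamondFreeEdges n m →
    (ε : ℚ) → 0ℚ < ε →
    ∃[ N ] Σ (Hypergraph3 N) λ G → 1 ≤ N ×
      ℚ._≤_ (divQ ((+ 2 / 1) * dval n m) (+ n / 1)) (edgeDensity G) ×
      (triforceDensity G < divQ (powQ (divQ ((+ 2 / 1) * dval n m) (+ n / 1)) 4) ((+ 8 / 1) * powQ (dval n m) 3) + ε)
lemma2p1 (suc k) (s≤s _) m ((F , diamondFree , edgeCount≡m) , _) ε 0<ε =
  suc k , H , s≤s z≤n , δ≤frac k m (edges3 H) 2m≤6e ,
  ℚP.≤-<-trans (frac≤triforceBound k m (triforceHoms H) homs≤2m) bound<bound+ε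
  where
  H : Hypergraph3 (suc k)
  H = triangleHypergraph F

  2m≤6e : 2 ℕ.* m ≤ 6 ℕ.* edges3 H
  2m≤6e = subst (λ x → 2 ℕ.* x ≤ 6 ℕ.* edges3 H) edgeCount≡m
    (subst (2 ℕ.* edgeCount F ≤_) (≡-sym (ℕP.*-assoc 2 3 (edges3 H)))
      (ℕP.*-monoʳ-≤ 2 (edgeCount≤3*edges3 F λ u v uv → ℕP.≤-reflexive (≡-sym (diamondFree u v uv)))))

  homs≤2m : triforceHoms H ≤ 2 ℕ.* m
  homs≤2m = subst (λ x → triforceHoms H ≤ 2 ℕ.* x) edgeCount≡m
    (triforceHoms≤2*edgeCount F λ u v uv → ℕP.≤-reflexive (diamondFree u v uv))

  bound<bound+ε : ∀ {b} → b < b + ε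
  bound<bound+ε {b} = subst (_< b + ε) (ℚP.+-identityʳ b) (ℚP.+-monoʳ-< b 0<ε)
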